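{- Let $(p\colon\mathbb{E}\to\mathbb{B},O,\Omega)$ be a $\mathbf{CLat}_\sqcap$-fibration with truth values indexed by discrete $A$, $F\colon\mathbb{B}\to\mathbb{B}$, $\tau\colon F\circ O\Rightarrow O$, and $(T,\lambda)$ an $N$-ary one-step composition for $F$-coalgebras. Let $q\colon\mathbb{F}\to\mathbb{B}$ be a $\mathbf{CLat}_\sqcap$-fibration and $G\colon\mathbb{E}\to\mathbb{F}$ a functor with $q\circ G=p$ that is full, fibered and preserves fibered meets. If a modality $\sigma\colon T\circ\langle O,\dots,O\rangle\Rightarrow O$ lifts $\lambda$ along $p$ (with truth values $\Omega$), then $\sigma$ lifts $\lambda$ also along $q$ with truth values $G\circ\Omega$.
   Context: A $\mathbf{CLat}_\sqcap$-fibration has complete-lattice fibers (order $\sqsubseteq$, meet $\bigwedge$) and meet-preserving reindexing; $O=p\circ\Omega$. An $N$-ary one-step composition is $T\colon\mathbb{B}^N\to\mathbb{B}$ with $\lambda\colon T\circ F^N\Rightarrow F\circ T$. With truth values $\Omega$, $F^{\Omega}_{\tau}(P)=\bigwedge_{a,\,k\in\mathbb{E}(P,\Omega(a))}(\tau_a\circ F(pk))^*\Omega(a)$ and $T^{\Omega}_{\sigma}(P_1,\dots,P_N)=\bigwedge_{a,\,k_i\in\mathbb{E}(P_i,\Omega(a))}(\sigma_a\circ T(pk_1,\dots,pk_N))^*\Omega(a)$ (analogously along $q$ with $G\circ\Omega$). "$\sigma$ lifts $\lambda$" means $T^{\Omega}_{\sigma}(F^{\Omega}_{\tau}P_1,\dots,F^{\Omega}_{\tau}P_N)\sqsubseteq\lambda^*F^{\Omega}_{\tau}(T^{\Omega}_{\sigma}(P_1,\dots,P_N))$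 for all $P_i$. Fibered means $G$ preserves Cartesian morphisms. -}

module Defs where

open import Level using (Level; _⊔_) renaming (suc to lsuc)
open import Data.Nat using (ℕ)
open import Data.Fin using (Fin)
open import Data.Product using (Σ; _,_; proj₁; proj₂; Σ-syntax)
open import Relation.Binary.PropositionalEquality using (_≡_)

record Category (ℓ : Level) : Set (lsuc ℓ) where
  infixr 9 _∘_
  field
    Obj : Set ℓ
    Hom : Obj → Obj → Set ℓ
    id  : ∀ {X} → Hom X X
    _∘_ : ∀ {X Y Z} → Hom Y Z → Hom X Y → Hom X Z
    identityˡ : ∀ {X Y} (f : Hom X Y) → id ∘ f ≡ f
    identityʳ : ∀ {X Y} (f : Hom X Y) → f ∘ id ≡ f
    assoc : ∀ {W X Y Z} (h : Hom Y Z) (g : Hom X Y) (f : Hom W X) →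
            (h ∘ g) ∘ f ≡ h ∘ (g ∘ f)

record Functor {ℓ} (B : Category ℓ) : Set ℓ where
  open Category B
  field
    F₀ : Obj → Obj
    F₁ : ∀ {X Y} → Hom X Y → Hom (F₀ X) (F₀ Y)
    F-id : ∀ {X} → F₁ (id {X}) ≡ id
    F-∘  : ∀ {X Y Z} (g : Hom Y Z) (f : Hom X Y) → F₁ (g ∘ f) ≡ F₁ g ∘ F₁ f

-- Functor T : B^N → B  (objects and morphisms of B^N are Fin N-indexed families)
record NaryFunctor {ℓ} (B : Category ℓ) (N : ℕ) : Set ℓ where
  open Category B
  field
    T₀ : (Fin N → Obj) → Obj
    T₁ : ∀ {X Y : Fin N → Obj} → (∀ i → Hom (X i) (Y i)) → Hom (T₀ X) (T₀ Y)
    T-id : ∀ {X : Fin N → Obj} → T₁ (λ i → id {X i}) ≡ id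
    T-∘  : ∀ {X Y Z : Fin N → Obj} (g : ∀ i → Hom (Y i) (Z i)) (f : ∀ i → Hom (X i) (Y i)) →
           T₁ (λ i → g i ∘ f i) ≡ T₁ g ∘ T₁ f

record OneStep {ℓ} {B : Category ℓ} {N : ℕ} (F : Functor B) (T : NaryFunctor B N) : Set ℓ where
  open Category B
  open Functor F
  open NaryFunctor T
  field
    λ-at : ∀ (X : Fin N → Obj) → Hom (T₀ (λ i → F₀ (X i))) (F₀ (T₀ X))
    natural : ∀ {X Y : Fin N → Obj} (f : ∀ i → Hom (X i) (Y i)) →
              F₁ (T₁ f) ∘ λ-at X ≡ λ-at Y ∘ T₁ (λ i → F₁ (f i))

-- CLat_⊓-fibrations over B, presented as displayed categories over B:
-- Ob[ X ] = objects of the fiber over X, Hom[ f ] P Q = morphisms P → Q of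
-- the total category lying over f.

record CLatFib {ℓ} (B : Category ℓ) : Set (lsuc ℓ) where
  open Category B
  field
    Ob[_]  : Obj → Set ℓ
    Hom[_] : ∀ {X Y} → Hom X Y → Ob[ X ] → Ob[ Y ] → Set ℓ
    idᵈ    : ∀ {X} {P : Ob[ X ]} → Hom[ id ] P P
    _∘ᵈ_   : ∀ {X Y Z} {g : Hom Y Z} {f : Hom X Y} {P Q R} →
             Hom[ g ] Q R → Hom[ f ] P Q → Hom[ g ∘ f ] P R
    thin   : ∀ {X Y} {f : Hom X Y} {P Q} (u v : Hom[ f ] P Q) → u ≡ v

  _⊑_ : ∀ {X} → Ob[ X ] → Ob[ X ] → Set ℓ
  P ⊑ Q = Hom[ id ] P Q

  -- Cartesian morphisms (uniqueness of the factorisation is automatic by thinness)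
  IsCartesian : ∀ {X Y} {f : Hom Y X} {Q : Ob[ Y ]} {P : Ob[ X ]} → Hom[ f ] Q P → Set ℓ
  IsCartesian {X} {Y} {f} {Q} {P} φ =
    ∀ {Z} (g : Hom Z Y) (R : Ob[ Z ]) → Hom[ f ∘ g ] R P → Hom[ g ] R Q

  field
    cleavage : ∀ {X Y} (f : Hom Y X) (P : Ob[ X ]) →
               Σ[ Q ∈ Ob[ Y ] ] Σ[ φ ∈ Hom[ f ] Q P ] IsCartesian φ

  reindex : ∀ {X Y} → Hom Y X → Ob[ X ] → Ob[ Y ]
  reindex f P = proj₁ (cleavage f P)

  field
    antisym : ∀ {X} {P Q : Ob[ X ]} → P ⊑ Q → Q ⊑ P → P ≡ Q
    ⋀ : ∀ {X} {I : Set ℓ} → (I → Ob[ X ]) → Ob[ X ]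
    ⋀-lower : ∀ {X} {I : Set ℓ} (P : I → Ob[ X ]) (i : I) → ⋀ P ⊑ P i
    ⋀-greatest : ∀ {X} {I : Set ℓ} (P : I → Ob[ X ]) (R : Ob[ X ]) →
                 (∀ i → R ⊑ P i) → R ⊑ ⋀ P
    reindex-⋀ : ∀ {X Y} {I : Set ℓ} (f : Hom Y X) (P : I → Ob[ X ]) →
                ⋀ (λ i → reindex f (P i)) ⊑ reindex f (⋀ P)

-- Functors G : E → F with q ∘ G = p (i.e. displayed functors over Id_B).
-- Functor laws are automatic since the fibrations are thin.

module _ {ℓ} {B : Category ℓ} where
  open Category B

  record FunctorOver (E 𝔽 : CLatFib B) : Set ℓ where
    private
      module E = CLatFib E
      module 𝔽 = CLatFib 𝔽
    field
      G₀ : ∀ {X} → E.Ob[ X ] → 𝔽.Ob[ X ]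
      G₁ : ∀ {X Y} {f : Hom X Y} {P Q} → E.Hom[ f ] P Q → 𝔽.Hom[ f ] (G₀ P) (G₀ Q)

  module _ {E 𝔽 : CLatFib B} (G : FunctorOver E 𝔽) where
    private
      module E = CLatFib E
      module 𝔽 = CLatFib 𝔽
    open FunctorOver G

    Full : Set ℓ
    Full = ∀ {X Y} {f : Hom X Y} {P Q} → 𝔽.Hom[ f ] (G₀ P) (G₀ Q) → E.Hom[ f ] P Q

    Fibered : Set ℓ
    Fibered = ∀ {X Y} {f : Hom Y X} {Q P} (φ : E.Hom[ f ] Q P) →
              E.IsCartesian φ → 𝔽.IsCartesian (G₁ φ)

    -- G preserves fibered meets (the other inequality holds by functoriality)
    PreservesMeets : Set (Level.suc ℓ)
    PreservesMeets = ∀ {X} {I : Set ℓ} (P : I → E.Ob[ X ]) →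
                     𝔽.⋀ (λ i → G₀ (P i)) 𝔽.⊑ G₀ (E.⋀ P)

-- Predicate liftings induced by truth values Ω : A → total objects
-- (A discrete, O a = p(Ω a), so Ω a lives in the fiber over O a).

module _ {ℓ} {B : Category ℓ} (E : CLatFib B) where
  open Category B
  open CLatFib E

  FΩ : (F : Functor B) {A : Set ℓ} (O : A → Obj) (Ω : ∀ a → Ob[ O a ])
       (τ : ∀ a → Hom (Functor.F₀ F (O a)) (O a)) →
       ∀ {X} → Ob[ X ] → Ob[ Functor.F₀ F X ]
  FΩ F {A} O Ω τ {X} P =
    ⋀ {I = Σ[ a ∈ A ] Σ[ f ∈ Hom X (O a) ] Hom[ f ] P (Ω a)}
      (λ { (a , f , _) → reindex (τ a ∘ Functor.F₁ F f) (Ω a) })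

  TΩ : {N : ℕ} (T : NaryFunctor B N) {A : Set ℓ} (O : A → Obj) (Ω : ∀ a → Ob[ O a ])
       (σ : ∀ a → Hom (NaryFunctor.T₀ T (λ _ → O a)) (O a)) →
       ∀ {X : Fin N → Obj} → (∀ i → Ob[ X i ]) → Ob[ NaryFunctor.T₀ T X ]
  TΩ T {A} O Ω σ {X} P =
    ⋀ {I = Σ[ a ∈ A ] Σ[ f ∈ (∀ i → Hom (X i) (O a)) ] (∀ i → Hom[ f i ] (P i) (Ω a))}
      (λ { (a , f , _) → reindex (σ a ∘ NaryFunctor.T₁ T f) (Ω a) })

  Lifts : {N : ℕ} (F : Functor B) (T : NaryFunctor B N) (lam : OneStep F T)
          {A : Set ℓ} (O : A → Obj) (Ω : ∀ a → Ob[ O a ])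
          (τ : ∀ a → Hom (Functor.F₀ F (O a)) (O a))
          (σ : ∀ a → Hom (NaryFunctor.T₀ T (λ _ → O a)) (O a)) → Set ℓ
  Lifts {N} F T lam O Ω τ σ =
    ∀ {X : Fin N → Obj} (P : ∀ i → Ob[ X i ]) →
      TΩ T O Ω σ (λ i → FΩ F O Ω τ (P i))
        ⊑ reindex (OneStep.λ-at lam X) (FΩ F O Ω τ (TΩ T O Ω σ P))

-- Both liftings F^Ω and T^Ω see a predicate only through its morphisms into
-- the truth values.  A full, fibered, meet-preserving G identifies these
-- morphisms in 𝔼 and in 𝔽 and commutes with the meets of reindexings that
-- define the liftings, so F^{GΩ} ∘ G = G ∘ F^Ω and T^{GΩ} ∘ G^N = G ∘ T^Ω.  An
-- arbitrary 𝔽-predicate Q is moreover indistinguishable, by morphisms into GΩ,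
-- from G applied to its hull in 𝔼 (the meet of the Ω-reindexings it maps to);
-- so the 𝔽-inequality is the image under G of the 𝔼-inequality at the hulls.
module Submission where

open import Defs
open import Data.Nat using (ℕ)
open import Data.Fin using (Fin)
open import Data.Product using (_,_; proj₁; proj₂; Σ-syntax)
open import Relation.Binary.PropositionalEquality using (_≡_; refl; subst; sym; cong; isEquivalence)
open import Relation.Binary.Structures using (IsPreorder)
import Relation.Binary.Reasoning.Base.Double as DoubleReasoning

module CLatFibProperties {ℓ} {B : Category ℓ} (C : CLatFib B) where
  open Category B
  open CLatFib C

  subst-Hom[] : ∀ {X Y} {f g : Hom X Y} {P Q} → f ≡ g → Hom[ f ] P Q → Hom[ g ] P Q
  subst-Hom[] {P = P} {Q} = subst (λ h → Hom[ h ] P Q)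

  infixr 9 _∘ᵛ_ _ᵛ∘_

  _∘ᵛ_ : ∀ {X Y} {f : Hom X Y} {P Q R} → Hom[ f ] Q R → P ⊑ Q → Hom[ f ] P R
  k ∘ᵛ u = subst-Hom[] (identityʳ _) (k ∘ᵈ u)

  _ᵛ∘_ : ∀ {X Y} {f : Hom X Y} {P Q R} → Q ⊑ R → Hom[ f ] P Q → Hom[ f ] P R
  u ᵛ∘ k = subst-Hom[] (identityˡ _) (u ∘ᵈ k)

  ⊑-trans : ∀ {X} {P Q R : Ob[ X ]} → P ⊑ Q → Q ⊑ R → P ⊑ R
  ⊑-trans u v = v ∘ᵛ u

  ⊑-reflexive : ∀ {X} {P Q : Ob[ X ]} → P ≡ Q → P ⊑ Q
  ⊑-reflexive refl = idᵈ

  ⊑-isPreorder : ∀ {X} → IsPreorder _≡_ (_⊑_ {X})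
  ⊑-isPreorder = record
    { isEquivalence = isEquivalence
    ; reflexive     = ⊑-reflexive
    ; trans         = ⊑-trans
    }

  module ⊑-Reasoning {X} = DoubleReasoning (⊑-isPreorder {X})

  reindex-lift : ∀ {X Y} {f : Hom Y X} {S} → Hom[ f ] (reindex f S) S
  reindex-lift {f = f} {S} = proj₁ (proj₂ (cleavage f S))

  reindex-universal : ∀ {X Y} {f : Hom Y X} {P S} → Hom[ f ] P S → P ⊑ reindex f S
  reindex-universal {f = f} {P} {S} k =
    proj₂ (proj₂ (cleavage f S)) id P (subst-Hom[] (sym (identityʳ f)) k)

  reindex-mono : ∀ {X Y} {f : Hom Y X} {S S'} → S ⊑ S' → reindex f S ⊑ reindex f S'
  reindex-mono u = reindex-universal (u ᵛ∘ reindex-lift)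

  ⋀-⊑-⋀ : ∀ {X} {I J : Set ℓ} {P : I → Ob[ X ]} {Q : J → Ob[ X ]} →
          (∀ j → Σ[ i ∈ I ] P i ⊑ Q j) → ⋀ P ⊑ ⋀ Q
  ⋀-⊑-⋀ {P = P} {Q} below =
    ⋀-greatest Q (⋀ P) (λ j → ⊑-trans (⋀-lower P (proj₁ (below j))) (proj₂ (below j)))

module TruthValueOrder {ℓ} {B : Category ℓ} (C : CLatFib B) {A : Set ℓ}
    (O : A → Category.Obj B) (Ω : ∀ a → CLatFib.Ob[_] C (O a)) where
  open Category B
  open CLatFib C
  open CLatFibProperties C

  infix 4 _⊑ᵗ_

  _⊑ᵗ_ : ∀ {X} → Ob[ X ] → Ob[ X ] → Set ℓ
  _⊑ᵗ_ {X} P Q = ∀ {a} {f : Hom X (O a)} → Hom[ f ] Q (Ω a) → Hom[ f ] P (Ω a)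

  ⊑⇒⊑ᵗ : ∀ {X} {P Q : Ob[ X ]} → P ⊑ Q → P ⊑ᵗ Q
  ⊑⇒⊑ᵗ u k = k ∘ᵛ u

  FΩ-mono : ∀ F τ {X} {P Q : Ob[ X ]} → P ⊑ᵗ Q → FΩ C F O Ω τ P ⊑ FΩ C F O Ω τ Q
  FΩ-mono F τ P⊑ᵗQ = ⋀-⊑-⋀ (λ { (a , f , k) → (a , f , P⊑ᵗQ k) , idᵈ })

  TΩ-mono : ∀ {N} (T : NaryFunctor B N) σ {X : Fin N → Obj} {P Q : ∀ i → Ob[ X i ]} →
            (∀ i → P i ⊑ᵗ Q i) → TΩ C T O Ω σ P ⊑ TΩ C T O Ω σ Q
  TΩ-mono T σ P⊑ᵗQ = ⋀-⊑-⋀ (λ { (a , f , k) → (a , f , λ i → P⊑ᵗQ i (k i)) , idᵈ })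

  TΩ-cong : ∀ {N} (T : NaryFunctor B N) σ {X : Fin N → Obj} {P Q : ∀ i → Ob[ X i ]} →
            (∀ i → P i ≡ Q i) → TΩ C T O Ω σ P ≡ TΩ C T O Ω σ Q
  TΩ-cong T σ P≡Q = antisym
    (TΩ-mono T σ (λ i → ⊑⇒⊑ᵗ (⊑-reflexive (P≡Q i))))
    (TΩ-mono T σ (λ i → ⊑⇒⊑ᵗ (⊑-reflexive (sym (P≡Q i)))))

module FunctorOverProperties {ℓ} {B : Category ℓ} {E 𝔽 : CLatFib B} (G : FunctorOver E 𝔽) where
  open Category B
  private
    module E = CLatFib E
    module E′ = CLatFibProperties E
  open CLatFib 𝔽
  open CLatFibProperties 𝔽
  open FunctorOver G

  G₀-⋀-⊑ : ∀ {X} {I : Set ℓ} {P : I → E.Ob[ X ]} → G₀ (E.⋀ P) ⊑ ⋀ (λ i → G₀ (P i))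
  G₀-⋀-⊑ {P = P} = ⋀-greatest _ _ (λ i → G₁ (E.⋀-lower P i))

  G₀-reindex-⊑ : ∀ {X Y} {f : Hom Y X} {S} → G₀ (E.reindex f S) ⊑ reindex f (G₀ S)
  G₀-reindex-⊑ = reindex-universal (G₁ E′.reindex-lift)

  reindex-G₀-⊑ : Fibered G → ∀ {X Y} {f : Hom Y X} {S} →
                 reindex f (G₀ S) ⊑ G₀ (E.reindex f S)
  reindex-G₀-⊑ fibered {f = f} {S} =
    fibered E′.reindex-lift (proj₂ (proj₂ (E.cleavage f S))) id _
      (subst-Hom[] (sym (identityʳ f)) reindex-lift)

module Transfer {ℓ} {B : Category ℓ} {E 𝔽 : CLatFib B} (G : FunctorOver E 𝔽)
    {A : Set ℓ} (O : A → Category.Obj B) (Ω : ∀ a → CLatFib.Ob[_] E (O a))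
    (F : Functor B) (τ : ∀ a → Category.Hom B (Functor.F₀ F (O a)) (O a))
    {N : ℕ} (T : NaryFunctor B N)
    (σ : ∀ a → Category.Hom B (NaryFunctor.T₀ T (λ _ → O a)) (O a)) where
  open Category B
  open Functor F using (F₀)
  open NaryFunctor T using (T₀)
  private
    module E = CLatFib E
    module E′ = CLatFibProperties E
  open CLatFib 𝔽
  open CLatFibProperties 𝔽
  open FunctorOver G
  open FunctorOverProperties G

  GΩ : ∀ a → Ob[ O a ]
  GΩ a = G₀ (Ω a)

  open TruthValueOrder 𝔽 O GΩ

  FΩᴱ : ∀ {X} → E.Ob[ X ] → E.Ob[ F₀ X ]
  FΩᴱ = FΩ E F O Ω τ

  TΩᴱ : ∀ {X : Fin N → Obj} → (∀ i → E.Ob[ X i ]) → E.Ob[ T₀ X ]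
  TΩᴱ = TΩ E T O Ω σ

  FΩ𝔽 : ∀ {X} → Ob[ X ] → Ob[ F₀ X ]
  FΩ𝔽 = FΩ 𝔽 F O GΩ τ

  TΩ𝔽 : ∀ {X : Fin N → Obj} → (∀ i → Ob[ X i ]) → Ob[ T₀ X ]
  TΩ𝔽 = TΩ 𝔽 T O GΩ σ

  hull : ∀ {X} → Ob[ X ] → E.Ob[ X ]
  hull {X} Q = E.⋀ {I = Σ[ a ∈ A ] Σ[ f ∈ Hom X (O a) ] Hom[ f ] Q (GΩ a)}
                 (λ { (a , f , _) → E.reindex f (Ω a) })

  G₀-hull-⊑ᵗ : ∀ {X} {Q : Ob[ X ]} → G₀ (hull Q) ⊑ᵗ Q
  G₀-hull-⊑ᵗ k = G₁ (E′.reindex-lift E′.∘ᵛ E.⋀-lower _ (_ , _ , k))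

  ⊑-G₀-hull : Fibered G → PreservesMeets G → ∀ {X} {Q : Ob[ X ]} → Q ⊑ G₀ (hull Q)
  ⊑-G₀-hull fibered preserves-⋀ = ⊑-trans
    (⋀-greatest _ _ (λ { (a , f , k) →
      ⊑-trans (reindex-universal k) (reindex-G₀-⊑ fibered) }))
    (preserves-⋀ _)

  G₀-FΩ-⊑ : Full G → ∀ {X} {R : E.Ob[ X ]} → G₀ (FΩᴱ R) ⊑ FΩ𝔽 (G₀ R)
  G₀-FΩ-⊑ full = ⊑-trans G₀-⋀-⊑ (⋀-⊑-⋀ (λ { (a , f , k) → (a , f , full k) , G₀-reindex-⊑ }))

  G₀-TΩ-⊑ : Full G → ∀ {X : Fin N → Obj} {R : ∀ i → E.Ob[ X i ]} →
            G₀ (TΩᴱ R) ⊑ TΩ𝔽 (λ i → G₀ (R i))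
  G₀-TΩ-⊑ full = ⊑-trans G₀-⋀-⊑
    (⋀-⊑-⋀ (λ { (a , f , k) → (a , f , λ i → full (k i)) , G₀-reindex-⊑ }))

  FΩ-G₀-⊑ : Fibered G → PreservesMeets G → ∀ {X} {R : E.Ob[ X ]} →
            FΩ𝔽 (G₀ R) ⊑ G₀ (FΩᴱ R)
  FΩ-G₀-⊑ fibered preserves-⋀ = ⊑-trans
    (⋀-⊑-⋀ (λ { (a , f , k) → (a , f , G₁ k) , reindex-G₀-⊑ fibered }))
    (preserves-⋀ _)

  TΩ-G₀-⊑ : Fibered G → PreservesMeets G → ∀ {X : Fin N → Obj} {R : ∀ i → E.Ob[ X i ]} →
            TΩ𝔽 (λ i → G₀ (R i)) ⊑ G₀ (TΩᴱ R)
  TΩ-G₀-⊑ fibered preserves-⋀ = ⊑-trans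
    (⋀-⊑-⋀ (λ { (a , f , k) → (a , f , λ i → G₁ (k i)) , reindex-G₀-⊑ fibered }))
    (preserves-⋀ _)

  module _ (full : Full G) (fibered : Fibered G) (preserves-⋀ : PreservesMeets G) where
    FΩ-hull : ∀ {X} (Q : Ob[ X ]) → FΩ𝔽 Q ≡ G₀ (FΩᴱ (hull Q))
    FΩ-hull Q = antisym
      (⊑-trans (FΩ-mono F τ (⊑⇒⊑ᵗ (⊑-G₀-hull fibered preserves-⋀)))
               (FΩ-G₀-⊑ fibered preserves-⋀))
      (⊑-trans (G₀-FΩ-⊑ full) (FΩ-mono F τ G₀-hull-⊑ᵗ))

    TΩ-hull : ∀ {X : Fin N → Obj} (Q : ∀ i → Ob[ X i ]) →
              TΩ𝔽 Q ≡ G₀ (TΩᴱ (λ i → hull (Q i)))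
    TΩ-hull Q = antisym
      (⊑-trans (TΩ-mono T σ (λ i → ⊑⇒⊑ᵗ (⊑-G₀-hull fibered preserves-⋀)))
               (TΩ-G₀-⊑ fibered preserves-⋀))
      (⊑-trans (G₀-TΩ-⊑ full) (TΩ-mono T σ (λ i → G₀-hull-⊑ᵗ)))

proposition9 : ∀ {ℓ} (B : Category ℓ) (E : CLatFib B) (A : Set ℓ)
    (O : A → Category.Obj B) (Ω : ∀ a → CLatFib.Ob[_] E (O a))
    (F : Functor B) (τ : ∀ a → Category.Hom B (Functor.F₀ F (O a)) (O a))
    (N : ℕ) (T : NaryFunctor B N) (lam : OneStep F T)
    (𝔽 : CLatFib B) (G : FunctorOver E 𝔽) →
    Full G → Fibered G → PreservesMeets G →
    (σ : ∀ a → Category.Hom B (NaryFunctor.T₀ T (λ _ → O a)) (O a)) →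
    Lifts E F T lam O Ω τ σ →
    Lifts 𝔽 F T lam O (λ a → FunctorOver.G₀ G (Ω a)) τ σ
proposition9 B E A O Ω F τ N T lam 𝔽 G full fibered preserves-⋀ σ lifts {X} P = begin
  TΩ𝔽 (λ i → FΩ𝔽 (P i))
    ≡⟨ TΩ-cong T σ (λ i → FΩ-hull full fibered preserves-⋀ (P i)) ⟩
  TΩ𝔽 (λ i → G₀ (FΩᴱ (R i)))
    ≲⟨ TΩ-G₀-⊑ fibered preserves-⋀ ⟩
  G₀ (TΩᴱ (λ i → FΩᴱ (R i)))
    ≲⟨ G₁ (lifts R) ⟩
  G₀ (E.reindex λX (FΩᴱ (TΩᴱ R)))
    ≲⟨ G₀-reindex-⊑ ⟩
  reindex λX (G₀ (FΩᴱ (TΩᴱ R)))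
    ≲⟨ reindex-mono (G₀-FΩ-⊑ full) ⟩
  reindex λX (FΩ𝔽 (G₀ (TΩᴱ R)))
    ≡⟨ cong (λ Q → reindex λX (FΩ𝔽 Q)) (TΩ-hull full fibered preserves-⋀ P) ⟨
  reindex λX (FΩ𝔽 (TΩ𝔽 P))
    ∎
  where
    module E = CLatFib E
    open CLatFib 𝔽
    open CLatFibProperties 𝔽
    open ⊑-Reasoning
    open FunctorOver G
    open FunctorOverProperties G
    open Transfer G O Ω F τ T σ
    open TruthValueOrder 𝔽 O GΩ

    λX : Category.Hom B (NaryFunctor.T₀ T (λ i → Functor.F₀ F (X i)))
                        (Functor.F₀ F (NaryFunctor.T₀ T X))
    λX = OneStep.λ-at lam X

    R : ∀ i → E.Ob[ X i ]
    R i = hull (P i)
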